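{- Let $\underline{L}$ be a finite lattice and $\underline{S}=[u,v]$ an interval of $\underline{L}$. If $\underline{S}$ is quasi-dismantling for $\underline{L}$, then $\underline{L}\setminus\underline{S}$ (the set $L\setminus S$ with the restricted order) is a lattice; in particular, $\underline{L}\setminus\underline{S}$ is a sublattice of $\underline{L}$.
   Context: For $u\le v$ in a lattice $L$, $[u,v]=\{x\mid u\le x\le v\}$, $(v]=\{x\mid x\le v\}$, $[u)=\{x\mid u\le x\}$. An interval $[u,v]$ is quasi-dismantling for $L$ if $u$ is supremum-prime in $(v]$ (for all $x,y\in (v]$: $u\le x\vee y$ implies $u\le x$ or $u\le y$) and $v$ is infimum-prime in $[u)$ (for all $x,y\in[u)$: $x\wedge y\le v$ implies $x\le v$ or $y\le v$). A subset $S$ of a lattice is a sublattice if it is closed under binary $\vee$ and $\wedge$. All sets are finite. -}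

module Defs where

open import Level using (Level; _⊔_)
open import Data.Nat using (ℕ)
open import Data.Fin using (Fin)
open import Data.Product using (Σ; ∃; _×_)
open import Data.Sum using (_⊎_)
open import Relation.Nullary using (¬_)
open import Relation.Binary.Lattice.Bundles using (Lattice)

module _ {c ℓ₁ ℓ₂ : Level} (L : Lattice c ℓ₁ ℓ₂) where
  open Lattice L

  IsFinite : Set (c ⊔ ℓ₁)
  IsFinite = Σ ℕ λ n → Σ (Fin n → Carrier) λ f → ∀ x → ∃ λ i → f i ≈ x

  _∈[_,_] : Carrier → Carrier → Carrier → Set ℓ₂
  x ∈[ u , v ] = u ≤ x × x ≤ v

  SupPrimeBelow : Carrier → Carrier → Set (c ⊔ ℓ₂)
  SupPrimeBelow u v = ∀ x y → x ≤ v → y ≤ v → u ≤ x ∨ y → u ≤ x ⊎ u ≤ y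

  InfPrimeAbove : Carrier → Carrier → Set (c ⊔ ℓ₂)
  InfPrimeAbove u v = ∀ x y → u ≤ x → u ≤ y → x ∧ y ≤ v → x ≤ v ⊎ y ≤ v

  QuasiDismantling : Carrier → Carrier → Set (c ⊔ ℓ₂)
  QuasiDismantling u v = SupPrimeBelow u v × InfPrimeAbove u v

  IsSublattice : ∀ {p} → (Carrier → Set p) → Set (c ⊔ p)
  IsSublattice P = (∀ x y → P x → P y → P (x ∨ y)) × (∀ x y → P x → P y → P (x ∧ y))

{-# OPTIONS --safe #-}
module Submission where

open import Defs
open import Level using (Level)
open import Relation.Nullary using (¬_)
open import Relation.Binary.Lattice.Bundles using (Lattice)
open import Data.Product using (_,_)
open import Data.Sum using ([_,_])

-- If x ∨ y lies in [u,v], then x, y ≤ v, so supremum-primality of u in (v]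
-- puts x or y above u, hence in [u,v]; dually for x ∧ y.

module _ {c ℓ₁ ℓ₂ : Level} (L : Lattice c ℓ₁ ℓ₂) where
  open Lattice L

  ∨-preserves-∉[,] : ∀ {u v} → SupPrimeBelow L u v → ∀ x y →
                      ¬ _∈[_,_] L x u v → ¬ _∈[_,_] L y u v → ¬ _∈[_,_] L (x ∨ y) u v
  ∨-preserves-∉[,] {u} {v} sp x y x∉ y∉ (u≤x∨y , x∨y≤v) =
    [ (λ u≤x → x∉ (u≤x , x≤v)) , (λ u≤y → y∉ (u≤y , y≤v)) ] (sp x y x≤v y≤v u≤x∨y)
    where
    x≤v : x ≤ v
    x≤v = trans (x≤x∨y x y) x∨y≤v
    y≤v : y ≤ v
    y≤v = trans (y≤x∨y x y) x∨y≤v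

  ∧-preserves-∉[,] : ∀ {u v} → InfPrimeAbove L u v → ∀ x y →
                      ¬ _∈[_,_] L x u v → ¬ _∈[_,_] L y u v → ¬ _∈[_,_] L (x ∧ y) u v
  ∧-preserves-∉[,] {u} {v} ip x y x∉ y∉ (u≤x∧y , x∧y≤v) =
    [ (λ x≤v → x∉ (u≤x , x≤v)) , (λ y≤v → y∉ (u≤y , y≤v)) ] (ip x y u≤x u≤y x∧y≤v)
    where
    u≤x : u ≤ x
    u≤x = trans u≤x∧y (x∧y≤x x y)
    u≤y : u ≤ y
    u≤y = trans u≤x∧y (x∧y≤y x y)

lemma3 : {c ℓ₁ ℓ₂ : Level} (L : Lattice c ℓ₁ ℓ₂) → IsFinite L →
    (u v : Lattice.Carrier L) → Lattice._≤_ L u v →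
    QuasiDismantling L u v →
    IsSublattice L (λ x → ¬ (_∈[_,_] L x u v))
lemma3 L _ u v _ (supPrime , infPrime) =
  ∨-preserves-∉[,] L supPrime , ∧-preserves-∉[,] L infPrime
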